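{- Let $Q$ be any integrally indecomposable polytope in $\mathbb{R}^m$ and $\pi:\mathbb{R}^n\to\mathbb{R}^m$ any integral linear map. Let $S$ be any set of integral points in $\pi^{ -1}(Q)$ having exactly one point in $\pi^{ -1}(v)$ for each vertex $v$ of $Q$. Then the polytope $\mathrm{conv}(S)$ in $\mathbb{R}^n$ is integrally indecomposable.
   Context: An integral polytope is a convex polytope whose vertices have integer coordinates. An integral polytope is integrally decomposable if it is the Minkowski sum $A+B=\{a+b:a\in A,b\in B\}$ of two integral polytopes $A,B$ each with more than one point, and integrally indecomposable otherwise (an integrally indecomposable polytope is in particular an integral polytope). A linear map $\pi:\mathbb{R}^n\to\mathbb{R}^m$ is integral if it maps points of $\mathbb{Z}^n$ to points of $\mathbb{Z}^m$. $\mathrm{conv}(S)$ denotes the convex hull of $S$.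
   Formalization: Each polytope, including $Q$, conv(S) and the summands, is represented by its set of rational points in ℚ^n or ℚ^m rather than as a subset of ℝ^n, and Minkowski sums and vertices are taken there. -}

module Defs where

open import Data.Nat using (ℕ; zero; suc)
open import Data.Fin using (Fin; zero; suc)
open import Data.Integer as ℤ using (ℤ)
open import Data.Rational using (ℚ; 0ℚ; 1ℚ; _+_; _*_; _-_; _≤_; _<_; _/_)
open import Data.List using (List; length; lookup)
open import Data.List.Membership.Propositional using (_∈_)
open import Data.Product using (Σ; ∃; _×_)
open import Relation.Binary.PropositionalEquality using (_≡_)
open import Relation.Nullary using (¬_)
open import Relation.Unary using (Pred)
open import Level using (0ℓ)

ℚVec : ℕ → Set
ℚVec n = Fin n → ℚ

ℤVec : ℕ → Set
ℤVec n = Fin n → ℤ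

-- Subsets of ℚ^n (rational points of a subset of ℝ^n).
Region : ℕ → Set₁
Region n = Pred (ℚVec n) 0ℓ

embed : ∀ {n} → ℤVec n → ℚVec n
embed z i = z i / 1

sumℚ : ∀ {k} → (Fin k → ℚ) → ℚ
sumℚ {zero}  f = 0ℚ
sumℚ {suc k} f = f zero + sumℚ (λ i → f (suc i))

sumℤ : ∀ {k} → (Fin k → ℤ) → ℤ
sumℤ {zero}  f = ℤ.0ℤ
sumℤ {suc k} f = f zero ℤ.+ sumℤ (λ i → f (suc i))

_≈ℚ_ : ∀ {n} → ℚVec n → ℚVec n → Set
x ≈ℚ y = ∀ i → x i ≡ y i

_≈ℤ_ : ∀ {n} → ℤVec n → ℤVec n → Set
x ≈ℤ y = ∀ i → x i ≡ y i

Conv : ∀ {n} → List (ℤVec n) → Region n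
Conv S x =
  Σ (Fin (length S) → ℚ) λ w →
    (∀ i → 0ℚ ≤ w i) × (sumℚ w ≡ 1ℚ) ×
    (∀ j → x j ≡ sumℚ (λ i → w i * embed (lookup S i) j))

_≐_ : ∀ {n} → Region n → Region n → Set
P ≐ R = ∀ x → (P x → R x) × (R x → P x)

_⊕_ : ∀ {n} → Region n → Region n → Region n
(A ⊕ B) x = Σ _ λ a → Σ _ λ b → A a × B b × (∀ j → x j ≡ a j + b j)

MoreThanOnePoint : ∀ {n} → Region n → Set
MoreThanOnePoint A = Σ _ λ a → Σ _ λ a' → A a × A a' × ¬ (a ≈ℚ a')

IsIntegralPolytope : ∀ {n} → Region n → Set
IsIntegralPolytope P = Σ (List (ℤVec _)) λ V → P ≐ Conv V

IntegrallyDecomposable : ∀ {n} → Region n → Set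
IntegrallyDecomposable {n} P =
  Σ (List (ℤVec n)) λ VA → Σ (List (ℤVec n)) λ VB →
    MoreThanOnePoint (Conv VA) × MoreThanOnePoint (Conv VB) ×
    (P ≐ (Conv VA ⊕ Conv VB))

IntegrallyIndecomposable : ∀ {n} → Region n → Set
IntegrallyIndecomposable P = IsIntegralPolytope P × ¬ IntegrallyDecomposable P

IsVertex : ∀ {n} → Region n → ℚVec n → Set
IsVertex P v =
  P v ×
  (∀ x y (t : ℚ) → 0ℚ < t → t < 1ℚ → P x → P y →
     (∀ j → v j ≡ t * x j + (1ℚ - t) * y j) → x ≈ℚ y)

IntMatrix : ℕ → ℕ → Set
IntMatrix m n = Fin m → Fin n → ℤ

apply : ∀ {m n} → IntMatrix m n → ℤVec n → ℤVec m
apply M s i = sumℤ (λ j → M i j ℤ.* s j)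

{-# OPTIONS --safe #-}
-- Write Q as the hull of its vertices (only up to double negation, which suffices since we prove
-- a negation) and suppose conv S = A + B with A, B integral and not points. The projection maps
-- conv S onto Q, because every vertex of Q is the image of a point of S, and it maps Minkowski
-- sums to Minkowski sums, so Q = π A + π B. If π A were a point, pick a vertex v of Q, write its
-- lift s_v = a + b with a ∈ A, b ∈ B; then A + b lies in conv S over v. But a convex combination
-- of points of Q equal to a vertex puts weight only on points equal to that vertex, and v has a
-- unique lift in S, so conv S meets the fibre over v only in s_v, and A is a point. Hence π A and
-- π B both have two points, contradicting the indecomposability of Q.
module Submission where

open import Defs
open import Data.Nat using (ℕ)
open import Data.List using (List)
open import Data.List.Membership.Propositional using (_∈_)
open import Data.Product using (Σ; _×_)

open import Algebra.Bundles using (CommutativeRing)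
open import Data.Nat using (zero; suc)
open import Data.Nat.Coprimality as Coprimality using (1-coprimeTo)
open import Data.Fin as Fin using (Fin; zero; suc; punchIn; punchOut)
open import Data.Fin.Properties using (all?; cast-is-id; punchIn-punchOut) renaming (_≟_ to _≟ᶠ_)
open import Data.Integer as ℤ using (ℤ)
import Data.Integer.Properties as ℤ
open import Data.Rational as ℚ using (ℚ; 0ℚ; 1ℚ; _+_; _*_; _-_; _≤_; _<_; _/_; mkℚ)
open import Data.Rational.Properties
import Data.Rational.Unnormalised as ℚᵘ
import Data.Rational.Unnormalised.Properties as ℚᵘ
open import Data.Rational.Solver using (module +-*-Solver)
open import Data.List using (_∷_; length; lookup; map)
open import Data.List.Properties using (length-map)
open import Data.List.Membership.Propositional.Properties using (∈-lookup)
open import Data.List.Relation.Unary.Any using (index)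
open import Data.List.Relation.Unary.Any.Properties using (lookup-index)
open import Data.Product using (_,_; proj₁; proj₂)
open import Data.Empty using (⊥-elim)
open import Relation.Nullary using (¬_; Dec; yes; no)
open import Relation.Unary using (_⊆_)
open import Relation.Binary.PropositionalEquality
open import Relation.Binary.Definitions using (tri<; tri≈; tri>)
open import Algebra.Properties.Group +-0-group using (∙-cancelʳ)

open import Algebra.Properties.Semiring.Sum (CommutativeRing.semiring +-*-commutativeRing)
  using (sum; sum-cong-≗; sum-replicate-zero; ∑-distrib-+; ∑-comm; *-distribˡ-sum; *-distribʳ-sum; sum-remove)

open +-*-Solver

fromℤ : ℤ → ℚ
fromℤ z = z / 1

toℚᵘ-fromℤ : ∀ z → ℚ.toℚᵘ (fromℤ z) ℚᵘ.≃ ℚᵘ.mkℚᵘ z 0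
toℚᵘ-fromℤ z = ℚᵘ.≃-reflexive (cong ℚ.toℚᵘ (↥p/↧p≡p (mkℚ z 0 (Coprimality.sym (1-coprimeTo _)))))

fromℤ-homo-+ : ∀ a b → fromℤ (a ℤ.+ b) ≡ fromℤ a + fromℤ b
fromℤ-homo-+ a b = toℚᵘ-injective (begin
  ℚ.toℚᵘ (fromℤ (a ℤ.+ b))                 ≈⟨ toℚᵘ-fromℤ (a ℤ.+ b) ⟩
  ℚᵘ.mkℚᵘ (a ℤ.+ b) 0                      ≈⟨ ℚᵘ.*≡* (cong (ℤ._* ℤ.+ 1) (sym (cong₂ ℤ._+_ (ℤ.*-identityʳ a) (ℤ.*-identityʳ b)))) ⟩
  ℚᵘ.mkℚᵘ a 0 ℚᵘ.+ ℚᵘ.mkℚᵘ b 0             ≈⟨ ℚᵘ.+-cong (toℚᵘ-fromℤ a) (toℚᵘ-fromℤ b) ⟨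
  ℚ.toℚᵘ (fromℤ a) ℚᵘ.+ ℚ.toℚᵘ (fromℤ b)   ≈⟨ toℚᵘ-homo-+ (fromℤ a) (fromℤ b) ⟨
  ℚ.toℚᵘ (fromℤ a + fromℤ b)               ∎)
  where open ℚᵘ.≃-Reasoning

fromℤ-homo-* : ∀ a b → fromℤ (a ℤ.* b) ≡ fromℤ a * fromℤ b
fromℤ-homo-* a b = toℚᵘ-injective (begin
  ℚ.toℚᵘ (fromℤ (a ℤ.* b))                 ≈⟨ toℚᵘ-fromℤ (a ℤ.* b) ⟩
  ℚᵘ.mkℚᵘ (a ℤ.* b) 0                      ≈⟨ ℚᵘ.*≡* refl ⟩
  ℚᵘ.mkℚᵘ a 0 ℚᵘ.* ℚᵘ.mkℚᵘ b 0             ≈⟨ ℚᵘ.*-cong (toℚᵘ-fromℤ a) (toℚᵘ-fromℤ b) ⟨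
  ℚ.toℚᵘ (fromℤ a) ℚᵘ.* ℚ.toℚᵘ (fromℤ b)   ≈⟨ toℚᵘ-homo-* (fromℤ a) (fromℤ b) ⟨
  ℚ.toℚᵘ (fromℤ a * fromℤ b)               ∎)
  where open ℚᵘ.≃-Reasoning

fromℤ-homo-sum : ∀ {k} (f : Fin k → ℤ) → fromℤ (sumℤ f) ≡ sumℚ (λ i → fromℤ (f i))
fromℤ-homo-sum {zero}  f = refl
fromℤ-homo-sum {suc k} f =
  trans (fromℤ-homo-+ (f zero) _) (cong (fromℤ (f zero) +_) (fromℤ-homo-sum (λ i → f (suc i))))

sumℚ≡sum : ∀ {k} (f : Fin k → ℚ) → sumℚ f ≡ sum f
sumℚ≡sum {zero}  f = refl
sumℚ≡sum {suc k} f = cong (f zero +_) (sumℚ≡sum (λ i → f (suc i)))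

sumℚ-cong : ∀ {k} {f g : Fin k → ℚ} → (∀ i → f i ≡ g i) → sumℚ f ≡ sumℚ g
sumℚ-cong {f = f} {g} f≗g = trans (sumℚ≡sum f) (trans (sum-cong-≗ {x = f} {g} f≗g) (sym (sumℚ≡sum g)))

sumℚ-zero : ∀ k → sumℚ {k} (λ _ → 0ℚ) ≡ 0ℚ
sumℚ-zero k = trans (sumℚ≡sum {k} (λ _ → 0ℚ)) (sum-replicate-zero k)

sumℚ-distrib-+ : ∀ {k} (f g : Fin k → ℚ) → sumℚ (λ i → f i + g i) ≡ sumℚ f + sumℚ g
sumℚ-distrib-+ f g =
  trans (sumℚ≡sum (λ i → f i + g i)) (trans (∑-distrib-+ f g) (sym (cong₂ _+_ (sumℚ≡sum f) (sumℚ≡sum g))))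

*-distribˡ-sumℚ : ∀ {k} c (f : Fin k → ℚ) → sumℚ (λ i → c * f i) ≡ c * sumℚ f
*-distribˡ-sumℚ c f = trans (sumℚ≡sum (λ i → c * f i)) (trans (sym (*-distribˡ-sum c f)) (cong (c *_) (sym (sumℚ≡sum f))))

*-distribʳ-sumℚ : ∀ {k} c (f : Fin k → ℚ) → sumℚ (λ i → f i * c) ≡ sumℚ f * c
*-distribʳ-sumℚ c f = trans (sumℚ≡sum (λ i → f i * c)) (trans (sym (*-distribʳ-sum c f)) (cong (_* c) (sym (sumℚ≡sum f))))

sumℚ-comm : ∀ {k l} (f : Fin k → Fin l → ℚ) →
  sumℚ (λ i → sumℚ (λ j → f i j)) ≡ sumℚ (λ j → sumℚ (λ i → f i j))
sumℚ-comm f = begin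
  sumℚ (λ i → sumℚ (f i))              ≡⟨ sumℚ≡sum (λ i → sumℚ (f i)) ⟩
  sum (λ i → sumℚ (f i))               ≡⟨ sum-cong-≗ (λ i → sumℚ≡sum (f i)) ⟩
  sum (λ i → sum (f i))                ≡⟨ ∑-comm f ⟩
  sum (λ j → sum (λ i → f i j))        ≡⟨ sum-cong-≗ (λ j → sumℚ≡sum (λ i → f i j)) ⟨
  sum (λ j → sumℚ (λ i → f i j))       ≡⟨ sumℚ≡sum (λ j → sumℚ (λ i → f i j)) ⟨
  sumℚ (λ j → sumℚ (λ i → f i j))      ∎
  where open ≡-Reasoning

sumℚ-remove : ∀ {k} (p : Fin (suc k)) (f : Fin (suc k) → ℚ) → sumℚ f ≡ f p + sumℚ (λ i → f (punchIn p i))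
sumℚ-remove p f = trans (sumℚ≡sum f) (trans (sum-remove {i = p} f) (cong (f p +_) (sym (sumℚ≡sum (λ i → f (punchIn p i))))))

+-nonNeg : ∀ {p q} → 0ℚ ≤ p → 0ℚ ≤ q → 0ℚ ≤ p + q
+-nonNeg {p} {q} 0≤p 0≤q =
  nonNegative⁻¹ _ {{nonNeg+nonNeg⇒nonNeg p {{ℚ.nonNegative 0≤p}} q {{ℚ.nonNegative 0≤q}}}}

*-nonNeg : ∀ {p q} → 0ℚ ≤ p → 0ℚ ≤ q → 0ℚ ≤ p * q
*-nonNeg {p} {q} 0≤p 0≤q =
  nonNegative⁻¹ _ {{nonNeg*nonNeg⇒nonNeg p {{ℚ.nonNegative 0≤p}} q {{ℚ.nonNegative 0≤q}}}}

sumℚ-nonNeg : ∀ {k} {f : Fin k → ℚ} → (∀ i → 0ℚ ≤ f i) → 0ℚ ≤ sumℚ f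
sumℚ-nonNeg {zero}  f≥0 = ≤-refl
sumℚ-nonNeg {suc k} f≥0 = +-nonNeg (f≥0 zero) (sumℚ-nonNeg (λ i → f≥0 (suc i)))

≤-sumℚ : ∀ {k} {f : Fin k → ℚ} → (∀ i → 0ℚ ≤ f i) → ∀ p → f p ≤ sumℚ f
≤-sumℚ {suc k} {f} f≥0 p = begin
  f p                                   ≡⟨ +-identityʳ (f p) ⟨
  f p + 0ℚ                              ≤⟨ +-monoʳ-≤ (f p) (sumℚ-nonNeg (λ i → f≥0 (punchIn p i))) ⟩
  f p + sumℚ (λ i → f (punchIn p i))    ≡⟨ sumℚ-remove p f ⟨
  sumℚ f                                ∎
  where open ≤-Reasoning

sumℚ≡0⇒≡0 : ∀ {k} {f : Fin k → ℚ} → (∀ i → 0ℚ ≤ f i) → sumℚ f ≡ 0ℚ → ∀ p → f p ≡ 0ℚ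
sumℚ≡0⇒≡0 f≥0 Σf≡0 p = ≤-antisym (subst (_ ≤_) Σf≡0 (≤-sumℚ f≥0 p)) (f≥0 p)

≐-refl : ∀ {n} {P : Region n} → P ≐ P
≐-refl x = (λ Px → Px) , (λ Px → Px)

≐-sym : ∀ {n} {P R : Region n} → P ≐ R → R ≐ P
≐-sym P≐R x = proj₂ (P≐R x) , proj₁ (P≐R x)

≐-trans : ∀ {n} {P R T : Region n} → P ≐ R → R ≐ T → P ≐ T
≐-trans P≐R R≐T x = (λ Px → proj₁ (R≐T x) (proj₁ (P≐R x) Px)) , (λ Tx → proj₂ (P≐R x) (proj₂ (R≐T x) Tx))

≐⇒⊆ : ∀ {n} {P R : Region n} → P ≐ R → P ⊆ R
≐⇒⊆ P≐R {x} = proj₁ (P≐R x)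

⊆-antisym : ∀ {n} {P R : Region n} → P ⊆ R → R ⊆ P → P ≐ R
⊆-antisym P⊆R R⊆P x = P⊆R , R⊆P

⊕-mono : ∀ {n} {A A' B B' : Region n} → A ⊆ A' → B ⊆ B' → (A ⊕ B) ⊆ (A' ⊕ B')
⊕-mono A⊆A' B⊆B' (a , b , Aa , Bb , x≡) = a , b , A⊆A' Aa , B⊆B' Bb , x≡

⊕-cong : ∀ {n} {A A' B B' : Region n} → A ≐ A' → B ≐ B' → (A ⊕ B) ≐ (A' ⊕ B')
⊕-cong A≐A' B≐B' = ⊆-antisym (⊕-mono (≐⇒⊆ A≐A') (≐⇒⊆ B≐B')) (⊕-mono (≐⇒⊆ (≐-sym A≐A')) (≐⇒⊆ (≐-sym B≐B')))

⊕-comm : ∀ {n} {A B : Region n} → (A ⊕ B) ≐ (B ⊕ A)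
⊕-comm = ⊆-antisym swap swap
  where
  swap : ∀ {n} {A B : Region n} → (A ⊕ B) ⊆ (B ⊕ A)
  swap (a , b , Aa , Bb , x≡) = b , a , Bb , Aa , λ j → trans (x≡ j) (+-comm (a j) (b j))

comb : ∀ {n k} → (Fin k → ℚ) → (Fin k → ℚVec n) → ℚVec n
comb w z j = sumℚ (λ i → w i * z i j)

Hull : ∀ {n k} → (Fin k → ℚVec n) → Region n
Hull z x = Σ (Fin _ → ℚ) λ w → (∀ i → 0ℚ ≤ w i) × (sumℚ w ≡ 1ℚ) × (∀ j → x j ≡ comb w z j)

-- Conv L is definitionally Hull (generators L).
generators : ∀ {n} (L : List (ℤVec n)) → Fin (length L) → ℚVec n
generators L i = embed (lookup L i)

Respects≈ : ∀ {n} → Region n → Set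
Respects≈ P = ∀ {x y} → x ≈ℚ y → P x → P y

IsConvex : ∀ {n} → Region n → Set
IsConvex {n} P = ∀ {k} (c : Fin k → ℚ) (y : Fin k → ℚVec n) →
  (∀ t → 0ℚ ≤ c t) → sumℚ c ≡ 1ℚ → (∀ t → P (y t)) → P (comb c y)

≐-respects≈ : ∀ {n} {P R : Region n} → P ≐ R → Respects≈ R → Respects≈ P
≐-respects≈ P≐R R-resp x≈y Px = proj₂ (P≐R _) (R-resp x≈y (proj₁ (P≐R _) Px))

≐-isConvex : ∀ {n} {P R : Region n} → P ≐ R → IsConvex R → IsConvex P
≐-isConvex P≐R R-convex c y c≥0 Σc≡1 Py = proj₂ (P≐R _) (R-convex c y c≥0 Σc≡1 (λ t → proj₁ (P≐R _) (Py t)))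

Hull-respects≈ : ∀ {n k} (z : Fin k → ℚVec n) → Respects≈ (Hull z)
Hull-respects≈ z x≈y (w , w≥0 , Σw≡1 , x≡) = w , w≥0 , Σw≡1 , λ j → trans (sym (x≈y j)) (x≡ j)

Hull-cong : ∀ {n k} {z z' : Fin k → ℚVec n} → (∀ i → z i ≈ℚ z' i) → Hull z ≐ Hull z'
Hull-cong {z = z} {z'} z≈z' = ⊆-antisym (replace z≈z') (replace (λ i j → sym (z≈z' i j)))
  where
  replace : ∀ {y y'} → (∀ i → y i ≈ℚ y' i) → Hull y ⊆ Hull y'
  replace y≈y' (w , w≥0 , Σw≡1 , x≡) =
    w , w≥0 , Σw≡1 , λ j → trans (x≡ j) (sumℚ-cong (λ i → cong (w i *_) (y≈y' i j)))

Hull-cast : ∀ {n k k'} (e : k ≡ k') (z : Fin k' → ℚVec n) → Hull (λ i → z (Fin.cast e i)) ≐ Hull z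
Hull-cast refl z = Hull-cong (λ i j → cong (λ i' → z i' j) (cast-is-id refl i))

Hull-isConvex : ∀ {n k} (z : Fin k → ℚVec n) → IsConvex (Hull z)
Hull-isConvex z c y c≥0 Σc≡1 y∈ = w , w≥0 , Σw≡1 , comb≡
  where
  W = λ t → proj₁ (y∈ t)
  w = λ i → sumℚ (λ t → c t * W t i)
  w≥0 : ∀ i → 0ℚ ≤ w i
  w≥0 i = sumℚ-nonNeg (λ t → *-nonNeg (c≥0 t) (proj₁ (proj₂ (y∈ t)) i))
  Σw≡1 : sumℚ w ≡ 1ℚ
  Σw≡1 = begin
    sumℚ w                                   ≡⟨ sumℚ-comm (λ i t → c t * W t i) ⟩
    sumℚ (λ t → sumℚ (λ i → c t * W t i))    ≡⟨ sumℚ-cong (λ t → *-distribˡ-sumℚ (c t) (W t)) ⟩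
    sumℚ (λ t → c t * sumℚ (W t))            ≡⟨ sumℚ-cong (λ t → cong (c t *_) (proj₁ (proj₂ (proj₂ (y∈ t))))) ⟩
    sumℚ (λ t → c t * 1ℚ)                    ≡⟨ sumℚ-cong (λ t → *-identityʳ (c t)) ⟩
    sumℚ c                                   ≡⟨ Σc≡1 ⟩
    1ℚ                                       ∎
    where open ≡-Reasoning
  comb≡ : ∀ j → comb c y j ≡ comb w z j
  comb≡ j = begin
    sumℚ (λ t → c t * y t j)                             ≡⟨ sumℚ-cong (λ t → cong (c t *_) (proj₂ (proj₂ (proj₂ (y∈ t))) j)) ⟩
    sumℚ (λ t → c t * sumℚ (λ i → W t i * z i j))        ≡⟨ sumℚ-cong (λ t → *-distribˡ-sumℚ (c t) (λ i → W t i * z i j)) ⟨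
    sumℚ (λ t → sumℚ (λ i → c t * (W t i * z i j)))      ≡⟨ sumℚ-comm (λ t i → c t * (W t i * z i j)) ⟩
    sumℚ (λ i → sumℚ (λ t → c t * (W t i * z i j)))      ≡⟨ sumℚ-cong (λ i → sumℚ-cong (λ t → *-assoc (c t) (W t i) (z i j))) ⟨
    sumℚ (λ i → sumℚ (λ t → c t * W t i * z i j))        ≡⟨ sumℚ-cong (λ i → *-distribʳ-sumℚ (z i j) (λ t → c t * W t i)) ⟩
    sumℚ (λ i → w i * z i j)                             ∎
    where open ≡-Reasoning

Hull-least : ∀ {n k} {P : Region n} (z : Fin k → ℚVec n) →
  IsConvex P → Respects≈ P → (∀ i → P (z i)) → Hull z ⊆ P
Hull-least z P-convex P-resp z∈P (w , w≥0 , Σw≡1 , x≡) =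
  P-resp (λ j → sym (x≡ j)) (P-convex w z w≥0 Σw≡1 z∈P)

δ : ∀ {k} → Fin k → Fin k → ℚ
δ zero    zero    = 1ℚ
δ zero    (suc i) = 0ℚ
δ (suc p) zero    = 0ℚ
δ (suc p) (suc i) = δ p i

δ-nonNeg : ∀ {k} (p i : Fin k) → 0ℚ ≤ δ p i
δ-nonNeg zero    zero    = <⇒≤ (positive⁻¹ 1ℚ)
δ-nonNeg zero    (suc i) = ≤-refl
δ-nonNeg (suc p) zero    = ≤-refl
δ-nonNeg (suc p) (suc i) = δ-nonNeg p i

sumℚ-δ : ∀ {k} (p : Fin k) (f : Fin k → ℚ) → sumℚ (λ i → δ p i * f i) ≡ f p
sumℚ-δ {suc k} zero f = begin
  1ℚ * f zero + sumℚ (λ i → 0ℚ * f (suc i))  ≡⟨ cong₂ _+_ (*-identityˡ (f zero)) (sumℚ-cong (λ i → *-zeroˡ (f (suc i)))) ⟩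
  f zero + sumℚ {k} (λ _ → 0ℚ)                ≡⟨ cong (f zero +_) (sumℚ-zero k) ⟩
  f zero + 0ℚ                                ≡⟨ +-identityʳ (f zero) ⟩
  f zero                                     ∎
  where open ≡-Reasoning
sumℚ-δ {suc k} (suc p) f =
  trans (cong₂ _+_ (*-zeroˡ (f zero)) (sumℚ-δ p (λ i → f (suc i)))) (+-identityˡ (f (suc p)))

Hull-generator : ∀ {n k} (z : Fin k → ℚVec n) p → Hull z (z p)
Hull-generator z p =
  δ p , δ-nonNeg p , trans (sumℚ-cong (λ i → sym (*-identityʳ (δ p i)))) (sumℚ-δ p (λ _ → 1ℚ)) ,
  λ j → sym (sumℚ-δ p (λ i → z i j))

Hull-⊆ : ∀ {n k l} {z : Fin k → ℚVec n} {z' : Fin l → ℚVec n} → (∀ i → Hull z' (z i)) → Hull z ⊆ Hull z'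
Hull-⊆ {z = z} {z'} = Hull-least z (Hull-isConvex z') (Hull-respects≈ z')

¬Hull-empty : ∀ {n} {z : Fin 0 → ℚVec n} {x} → ¬ Hull z x
¬Hull-empty (w , w≥0 , () , x≡)

p<q⇒0<q-p : ∀ {p q} → p < q → 0ℚ < q - p
p<q⇒0<q-p {p} {q} p<q = subst (_< q - p) (+-inverseʳ p) (+-monoˡ-< (ℚ.- p) p<q)

positive-inverse : ∀ μ → 0ℚ < μ → Σ ℚ λ ν → 0ℚ ≤ ν × μ * ν ≡ 1ℚ
positive-inverse μ μ>0 = ℚ.1/ μ , <⇒≤ (positive⁻¹ (ℚ.1/ μ) {{1/pos⇒pos μ}}) , *-inverseʳ μ
  where
  instance
    μ-positive : ℚ.Positive μ
    μ-positive = ℚ.positive μ>0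
    μ-nonZero : ℚ.NonZero μ
    μ-nonZero = pos⇒nonZero μ

*-cancelˡ-pos : ∀ {μ a b} → 0ℚ < μ → μ * a ≡ μ * b → a ≡ b
*-cancelˡ-pos {μ} {a} {b} μ>0 μa≡μb with positive-inverse μ μ>0
... | ν , _ , μν≡1 = begin
  a               ≡⟨ *-identityˡ a ⟨
  1ℚ * a          ≡⟨ cong (_* a) μν≡1 ⟨
  μ * ν * a       ≡⟨ solve 3 (λ μ ν a → μ :* ν :* a := ν :* (μ :* a)) refl μ ν a ⟩
  ν * (μ * a)     ≡⟨ cong (ν *_) μa≡μb ⟩
  ν * (μ * b)     ≡⟨ solve 3 (λ μ ν b → ν :* (μ :* b) := μ :* ν :* b) refl μ ν b ⟩
  μ * ν * b       ≡⟨ cong (_* b) μν≡1 ⟩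
  1ℚ * b          ≡⟨ *-identityˡ b ⟩
  b               ∎
  where open ≡-Reasoning

affine-cancel : ∀ {c y r} → c < 1ℚ → y ≡ c * y + (1ℚ - c) * r → y ≡ r
affine-cancel {c} {y} {r} c<1 y≡ = *-cancelˡ-pos (p<q⇒0<q-p c<1) (begin
  (1ℚ - c) * y                     ≡⟨ solve 2 (λ c y → (con 1ℚ :- c) :* y := y :- c :* y) refl c y ⟩
  y - c * y                        ≡⟨ cong (_- c * y) y≡ ⟩
  c * y + (1ℚ - c) * r - c * y     ≡⟨ solve 3 (λ c y r → c :* y :+ (con 1ℚ :- c) :* r :- c :* y := (con 1ℚ :- c) :* r) refl c y r ⟩
  (1ℚ - c) * r                     ∎)
  where open ≡-Reasoning

module _ {n k} (w : Fin (suc k) → ℚ) (z : Fin (suc k) → ℚVec n)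
         (w≥0 : ∀ i → 0ℚ ≤ w i) (Σw≡1 : sumℚ w ≡ 1ℚ) (p : Fin (suc k)) where

  private
    rest : Fin k → ℚ
    rest i = w (punchIn p i)

    z' : Fin k → ℚVec n
    z' i = z (punchIn p i)

    comb-remove : ∀ j → comb w z j ≡ w p * z p j + comb rest z' j
    comb-remove j = sumℚ-remove p (λ i → w i * z i j)

    Σrest : sumℚ rest ≡ 1ℚ - w p
    Σrest = begin
      sumℚ rest                  ≡⟨ solve 2 (λ r a → r := a :+ r :- a) refl (sumℚ rest) (w p) ⟩
      w p + sumℚ rest - w p      ≡⟨ cong (_- w p) (trans (sym (sumℚ-remove p w)) Σw≡1) ⟩
      1ℚ - w p                   ∎
      where open ≡-Reasoning

  comb-concentrated : 1ℚ ≤ w p → comb w z ≈ℚ z p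
  comb-concentrated 1≤wp j = begin
    comb w z j                                  ≡⟨ comb-remove j ⟩
    w p * z p j + sumℚ (λ i → rest i * z' i j)  ≡⟨ cong₂ _+_ (cong (_* z p j) wp≡1) (sumℚ-cong rest-term≡0) ⟩
    1ℚ * z p j + sumℚ {k} (λ _ → 0ℚ)            ≡⟨ cong (1ℚ * z p j +_) (sumℚ-zero k) ⟩
    1ℚ * z p j + 0ℚ                             ≡⟨ solve 1 (λ x → con 1ℚ :* x :+ con 0ℚ := x) refl (z p j) ⟩
    z p j                                       ∎
    where
    open ≡-Reasoning
    wp≡1 : w p ≡ 1ℚ
    wp≡1 = ≤-antisym (subst (w p ≤_) Σw≡1 (≤-sumℚ w≥0 p)) 1≤wp
    rest≡0 : ∀ i → rest i ≡ 0ℚ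
    rest≡0 = sumℚ≡0⇒≡0 (λ i → w≥0 (punchIn p i)) (trans Σrest (trans (cong (1ℚ -_) wp≡1) (+-inverseʳ 1ℚ)))
    rest-term≡0 : ∀ i → rest i * z' i j ≡ 0ℚ
    rest-term≡0 i = trans (cong (_* z' i j) (rest≡0 i)) (*-zeroˡ (z' i j))

  comb-split : w p < 1ℚ →
    Σ (Fin k → ℚ) λ w' → (∀ i → 0ℚ ≤ w' i) × (sumℚ w' ≡ 1ℚ) ×
      (∀ j → comb w z j ≡ w p * z p j + (1ℚ - w p) * comb w' z' j)
  comb-split wp<1 with positive-inverse (1ℚ - w p) (p<q⇒0<q-p wp<1)
  ... | ν , ν≥0 , μν≡1 = w' , (λ i → *-nonNeg (w≥0 (punchIn p i)) ν≥0) , Σw'≡1 , split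
    where
    μ = 1ℚ - w p
    w' : Fin k → ℚ
    w' i = rest i * ν
    Σw'≡1 : sumℚ w' ≡ 1ℚ
    Σw'≡1 = trans (*-distribʳ-sumℚ ν rest) (trans (cong (_* ν) Σrest) μν≡1)
    rescale : ∀ j i → μ * (w' i * z' i j) ≡ rest i * z' i j
    rescale j i = begin
      μ * (rest i * ν * z' i j)    ≡⟨ solve 4 (λ μ ν r x → μ :* (r :* ν :* x) := μ :* ν :* (r :* x)) refl μ ν (rest i) (z' i j) ⟩
      μ * ν * (rest i * z' i j)    ≡⟨ cong (_* (rest i * z' i j)) μν≡1 ⟩
      1ℚ * (rest i * z' i j)       ≡⟨ *-identityˡ _ ⟩
      rest i * z' i j              ∎
      where open ≡-Reasoning
    split : ∀ j → comb w z j ≡ w p * z p j + μ * comb w' z' j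
    split j = trans (comb-remove j) (cong (w p * z p j +_)
      (sym (trans (sym (*-distribˡ-sumℚ μ (λ i → w' i * z' i j))) (sumℚ-cong (rescale j)))))

sumℚ-mix : ∀ {k} (t s : ℚ) (f g : Fin k → ℚ) →
  sumℚ (λ i → t * f i + s * g i) ≡ t * sumℚ f + s * sumℚ g
sumℚ-mix t s f g = trans (sumℚ-distrib-+ (λ i → t * f i) (λ i → s * g i))
  (cong₂ _+_ (*-distribˡ-sumℚ t f) (*-distribˡ-sumℚ s g))

1≤mix⇒1≤ˡ : ∀ {t s a b} → 0ℚ < t → 0ℚ ≤ s → t + s ≡ 1ℚ → b ≤ 1ℚ → 1ℚ ≤ t * a + s * b → 1ℚ ≤ a
1≤mix⇒1≤ˡ {t} {s} {a} {b} t>0 s≥0 t+s≡1 b≤1 1≤mix with 1ℚ ≤? a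
... | yes 1≤a = 1≤a
... | no 1≰a = ⊥-elim (<-irrefl refl (≤-<-trans 1≤mix mix<1))
  where
  mix<1 : t * a + s * b < 1ℚ
  mix<1 = begin-strict
    t * a + s * b      <⟨ +-mono-<-≤ (*-monoʳ-<-pos t {{ℚ.positive t>0}} (≰⇒> 1≰a))
                            (*-monoˡ-≤-nonNeg s {{ℚ.nonNegative s≥0}} b≤1) ⟩
    t * 1ℚ + s * 1ℚ    ≡⟨ cong₂ _+_ (*-identityʳ t) (*-identityʳ s) ⟩
    t + s              ≡⟨ t+s≡1 ⟩
    1ℚ                 ∎
    where open ≤-Reasoning

vertex-support : ∀ {n k} {Q : Region n} {v} → IsConvex Q → IsVertex Q v →
  (w : Fin k → ℚ) (z : Fin k → ℚVec n) → (∀ i → 0ℚ ≤ w i) → sumℚ w ≡ 1ℚ → (∀ i → Q (z i)) →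
  (∀ j → v j ≡ comb w z j) → ∀ p → 0ℚ < w p → z p ≈ℚ v
vertex-support {k = suc k} {v = v} Q-convex (_ , extreme) w z w≥0 Σw≡1 z∈Q v≡ p wp>0 = support (1ℚ ≤? w p)
  where
  support : Dec (1ℚ ≤ w p) → z p ≈ℚ v
  support (yes 1≤wp) j = sym (trans (v≡ j) (comb-concentrated w z w≥0 Σw≡1 p 1≤wp j))
  support (no 1≰wp) j = sym (begin
    v j                                    ≡⟨ trans (v≡ j) (split j) ⟩
    w p * z p j + (1ℚ - w p) * r j         ≡⟨ cong (λ u → w p * z p j + (1ℚ - w p) * u) (zp≈r j) ⟨
    w p * z p j + (1ℚ - w p) * z p j       ≡⟨ solve 2 (λ a x → a :* x :+ (con 1ℚ :- a) :* x := x) refl (w p) (z p j) ⟩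
    z p j                                  ∎)
    where
    open ≡-Reasoning
    rest = comb-split w z w≥0 Σw≡1 p (≰⇒> 1≰wp)
    w' = proj₁ rest
    r : ℚVec _
    r = comb w' (λ i → z (punchIn p i))
    split : ∀ j → comb w z j ≡ w p * z p j + (1ℚ - w p) * r j
    split = proj₂ (proj₂ (proj₂ rest))
    zp≈r : z p ≈ℚ r
    zp≈r = extreme (z p) r (w p) wp>0 (≰⇒> 1≰wp) (z∈Q p)
      (Q-convex w' (λ i → z (punchIn p i)) (proj₁ (proj₂ rest)) (proj₁ (proj₂ (proj₂ rest))) (λ i → z∈Q (punchIn p i)))
      (λ j → trans (v≡ j) (split j))

Hull-drop : ∀ {n k} (ys : Fin (suc k) → ℚVec n) p → Hull (λ i → ys (punchIn p i)) (ys p) →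
  Hull ys ≐ Hull (λ i → ys (punchIn p i))
Hull-drop ys p yp∈ =
  ⊆-antisym (Hull-⊆ {z = ys} generator∈) (Hull-⊆ {z' = ys} (λ i → Hull-generator ys (punchIn p i)))
  where
  generator∈ : ∀ i → Hull (λ i → ys (punchIn p i)) (ys i)
  generator∈ i with p ≟ᶠ i
  ... | yes refl = yp∈
  ... | no p≢i = subst (λ i → Hull (λ i → ys (punchIn p i)) (ys i)) (punchIn-punchOut p≢i)
                   (Hull-generator (λ i → ys (punchIn p i)) (punchOut p≢i))

redundant-generator : ∀ {n k} {Q : Region n} (ys : Fin (suc k) → ℚVec n) → Q ≐ Hull ys →
  ∀ p {x y t} → 0ℚ < t → t < 1ℚ → Q x → Q y → (∀ j → ys p j ≡ t * x j + (1ℚ - t) * y j) → ¬ x ≈ℚ y →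
  Hull (λ i → ys (punchIn p i)) (ys p)
redundant-generator ys Q≐ p {x} {y} {t} t>0 t<1 Qx Qy yp≡ x≉y
  with proj₁ (Q≐ x) Qx | proj₁ (Q≐ y) Qy
... | a , a≥0 , Σa≡1 , x≡ | b , b≥0 , Σb≡1 , y≡ = drop (1ℚ ≤? c p)
  where
  s = 1ℚ - t
  t+s≡1 : t + s ≡ 1ℚ
  t+s≡1 = solve 1 (λ t → t :+ (con 1ℚ :- t) := con 1ℚ) refl t
  c : Fin _ → ℚ
  c i = t * a i + s * b i
  c≥0 : ∀ i → 0ℚ ≤ c i
  c≥0 i = +-nonNeg (*-nonNeg (<⇒≤ t>0) (a≥0 i)) (*-nonNeg (<⇒≤ (p<q⇒0<q-p t<1)) (b≥0 i))
  Σc≡1 : sumℚ c ≡ 1ℚ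
  Σc≡1 = trans (sumℚ-mix t s a b) (trans (cong₂ (λ u v → t * u + s * v) Σa≡1 Σb≡1)
                 (trans (cong₂ _+_ (*-identityʳ t) (*-identityʳ s)) t+s≡1))
  yp≈comb : ∀ j → ys p j ≡ comb c ys j
  yp≈comb j = begin
    ys p j                                     ≡⟨ yp≡ j ⟩
    t * x j + s * y j                          ≡⟨ cong₂ (λ u v → t * u + s * v) (x≡ j) (y≡ j) ⟩
    t * comb a ys j + s * comb b ys j          ≡⟨ sumℚ-mix t s (λ i → a i * ys i j) (λ i → b i * ys i j) ⟨
    sumℚ (λ i → t * (a i * ys i j) + s * (b i * ys i j))
      ≡⟨ sumℚ-cong (λ i → solve 5 (λ t s a b y → t :* (a :* y) :+ s :* (b :* y) := (t :* a :+ s :* b) :* y)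
                                   refl t s (a i) (b i) (ys i j)) ⟩
    comb c ys j                                ∎
    where open ≡-Reasoning
  drop : Dec (1ℚ ≤ c p) → Hull (λ i → ys (punchIn p i)) (ys p)
  drop (yes 1≤cp) = ⊥-elim (x≉y (λ j → trans (x≈yp j) (sym (y≈yp j))))
    where
    1≤ap = 1≤mix⇒1≤ˡ t>0 (<⇒≤ (p<q⇒0<q-p t<1)) t+s≡1 (subst (b p ≤_) Σb≡1 (≤-sumℚ b≥0 p)) 1≤cp
    1≤bp = 1≤mix⇒1≤ˡ (p<q⇒0<q-p t<1) (<⇒≤ t>0) (trans (+-comm s t) t+s≡1)
             (subst (a p ≤_) Σa≡1 (≤-sumℚ a≥0 p)) (subst (1ℚ ≤_) (+-comm (t * a p) (s * b p)) 1≤cp)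
    x≈yp : x ≈ℚ ys p
    x≈yp j = trans (x≡ j) (comb-concentrated a ys a≥0 Σa≡1 p 1≤ap j)
    y≈yp : y ≈ℚ ys p
    y≈yp j = trans (y≡ j) (comb-concentrated b ys b≥0 Σb≡1 p 1≤bp j)
  drop (no 1≰cp) =
    let (w' , w'≥0 , Σw'≡1 , split) = comb-split c ys c≥0 Σc≡1 p (≰⇒> 1≰cp)
    in  w' , w'≥0 , Σw'≡1 , λ j → affine-cancel (≰⇒> 1≰cp) (trans (yp≈comb j) (split j))

_≈ℚ?_ : ∀ {n} (x y : ℚVec n) → Dec (x ≈ℚ y)
x ≈ℚ? y = all? (λ i → x i ℚ.≟ y i)

record VertexHull {n} (Q : Region n) : Set where
  field
    size     : ℕ
    vertex   : Fin size → ℚVec n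
    isVertex : ∀ i → IsVertex Q (vertex i)
    spans    : Q ≐ Hull vertex

-- Assuming no vertex presentation exists, a generator with a proper decomposition could be
-- dropped and the recursion would give a contradiction; so every generator is extreme.
¬¬vertexHull : ∀ {n k} {Q : Region n} (ys : Fin k → ℚVec n) → Q ≐ Hull ys → ¬ ¬ VertexHull Q
¬¬vertexHull {k = zero} ys Q≐ noHull =
  noHull (record { size = 0 ; vertex = ys ; isVertex = λ () ; spans = Q≐ })
¬¬vertexHull {k = suc k} {Q} ys Q≐ noHull =
  noHull (record { size = suc k ; vertex = ys ; isVertex = generator-isVertex ; spans = Q≐ })
  where
  generator-isVertex : ∀ p → IsVertex Q (ys p)
  generator-isVertex p = proj₂ (Q≐ (ys p)) (Hull-generator ys p) , extreme
    where
    extreme : ∀ x y t → 0ℚ < t → t < 1ℚ → Q x → Q y → (∀ j → ys p j ≡ t * x j + (1ℚ - t) * y j) → x ≈ℚ y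
    extreme x y t t>0 t<1 Qx Qy yp≡ with x ≈ℚ? y
    ... | yes x≈y = x≈y
    ... | no x≉y = ⊥-elim (¬¬vertexHull (λ i → ys (punchIn p i))
                      (≐-trans Q≐ (Hull-drop ys p (redundant-generator ys Q≐ p t>0 t<1 Qx Qy yp≡ x≉y))) noHull)

vertex-exists : ∀ {n} {Q : Region n} {x} → VertexHull Q → Q x → Σ (ℚVec n) (IsVertex Q)
vertex-exists {x = x} record { size = zero ; vertex = vs ; spans = Q≐ } Qx = ⊥-elim (¬Hull-empty {z = vs} (proj₁ (Q≐ x) Qx))
vertex-exists record { size = suc _ ; vertex = vs ; isVertex = vs-vertex } Qx = vs zero , vs-vertex zero

applyℚ : ∀ {m n} → IntMatrix m n → ℚVec n → ℚVec m
applyℚ M x i = sumℚ (λ j → fromℤ (M i j) * x j)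

Image : ∀ {m n} → IntMatrix m n → Region n → Region m
Image {n = n} M P y = Σ (ℚVec n) λ x → P x × applyℚ M x ≈ℚ y

lookup-map : ∀ {A B : Set} (f : A → B) (L : List A) i →
  lookup (map f L) i ≡ f (lookup L (Fin.cast (length-map f L) i))
lookup-map f (x ∷ L) zero    = refl
lookup-map f (x ∷ L) (suc i) = lookup-map f L i

module _ {m n} (M : IntMatrix m n) where

  applyℚ-embed : ∀ s → applyℚ M (embed s) ≈ℚ embed (apply M s)
  applyℚ-embed s i = sym (trans (fromℤ-homo-sum (λ j → M i j ℤ.* s j)) (sumℚ-cong (λ j → fromℤ-homo-* (M i j) (s j))))

  applyℚ-cong : ∀ {x y} → x ≈ℚ y → applyℚ M x ≈ℚ applyℚ M y
  applyℚ-cong x≈y i = sumℚ-cong (λ j → cong (fromℤ (M i j) *_) (x≈y j))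

  applyℚ-+ : ∀ x y i → applyℚ M (λ j → x j + y j) i ≡ applyℚ M x i + applyℚ M y i
  applyℚ-+ x y i = trans (sumℚ-cong (λ j → *-distribˡ-+ (fromℤ (M i j)) (x j) (y j)))
                         (sumℚ-distrib-+ (λ j → fromℤ (M i j) * x j) (λ j → fromℤ (M i j) * y j))

  applyℚ-comb : ∀ {k} (w : Fin k → ℚ) (z : Fin k → ℚVec n) i →
    applyℚ M (comb w z) i ≡ comb w (λ t → applyℚ M (z t)) i
  applyℚ-comb w z i = begin
    sumℚ (λ j → fromℤ (M i j) * sumℚ (λ t → w t * z t j))     ≡⟨ sumℚ-cong (λ j → *-distribˡ-sumℚ (fromℤ (M i j)) (λ t → w t * z t j)) ⟨
    sumℚ (λ j → sumℚ (λ t → fromℤ (M i j) * (w t * z t j)))   ≡⟨ sumℚ-comm (λ j t → fromℤ (M i j) * (w t * z t j)) ⟩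
    sumℚ (λ t → sumℚ (λ j → fromℤ (M i j) * (w t * z t j)))
      ≡⟨ sumℚ-cong (λ t → sumℚ-cong (λ j → solve 3 (λ a b c → a :* (b :* c) := b :* (a :* c)) refl (fromℤ (M i j)) (w t) (z t j))) ⟩
    sumℚ (λ t → sumℚ (λ j → w t * (fromℤ (M i j) * z t j)))   ≡⟨ sumℚ-cong (λ t → *-distribˡ-sumℚ (w t) (λ j → fromℤ (M i j) * z t j)) ⟩
    sumℚ (λ t → w t * applyℚ M (z t) i)                       ∎
    where open ≡-Reasoning

  Image-mono : ∀ {P R : Region n} → P ⊆ R → Image M P ⊆ Image M R
  Image-mono P⊆R (x , Px , Mx≈y) = x , P⊆R Px , Mx≈y

  Image-cong : ∀ {P R : Region n} → P ≐ R → Image M P ≐ Image M R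
  Image-cong P≐R = ⊆-antisym (Image-mono (≐⇒⊆ P≐R)) (Image-mono (≐⇒⊆ (≐-sym P≐R)))

  Image-⊕ : ∀ {A B : Region n} → Image M (A ⊕ B) ≐ (Image M A ⊕ Image M B)
  Image-⊕ = ⊆-antisym split join
    where
    split : ∀ {A B} → Image M (A ⊕ B) ⊆ (Image M A ⊕ Image M B)
    split (x , (a , b , Aa , Bb , x≡) , Mx≈y) =
      applyℚ M a , applyℚ M b , (a , Aa , λ i → refl) , (b , Bb , λ i → refl) ,
      λ i → trans (sym (Mx≈y i)) (trans (applyℚ-cong x≡ i) (applyℚ-+ a b i))
    join : ∀ {A B} → (Image M A ⊕ Image M B) ⊆ Image M (A ⊕ B)
    join (a' , b' , (a , Aa , Ma≈a') , (b , Bb , Mb≈b') , y≡) =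
      (λ j → a j + b j) , (a , b , Aa , Bb , λ j → refl) ,
      λ i → trans (applyℚ-+ a b i) (trans (cong₂ _+_ (Ma≈a' i) (Mb≈b' i)) (sym (y≡ i)))

  Image-Hull : ∀ {k} (z : Fin k → ℚVec n) → Image M (Hull z) ≐ Hull (λ t → applyℚ M (z t))
  Image-Hull z = ⊆-antisym forward backward
    where
    forward : Image M (Hull z) ⊆ Hull (λ t → applyℚ M (z t))
    forward (x , (w , w≥0 , Σw≡1 , x≡) , Mx≈y) =
      w , w≥0 , Σw≡1 , λ i → trans (sym (Mx≈y i)) (trans (applyℚ-cong x≡ i) (applyℚ-comb w z i))
    backward : Hull (λ t → applyℚ M (z t)) ⊆ Image M (Hull z)
    backward (w , w≥0 , Σw≡1 , y≡) =
      comb w z , (w , w≥0 , Σw≡1 , λ j → refl) , λ i → trans (applyℚ-comb w z i) (sym (y≡ i))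

  Image-Conv : ∀ L → Image M (Conv L) ≐ Conv (map (apply M) L)
  Image-Conv L =
    ≐-trans (Image-Hull (generators L))
      (≐-trans (Hull-cong (λ t → applyℚ-embed (lookup L t)))
        (≐-trans (≐-sym (Hull-cast (length-map (apply M) L) (λ t → embed (apply M (lookup L t)))))
          (Hull-cong (λ i j → sym (cong (λ s → embed s j) (lookup-map (apply M) L i))))))

comb-constant : ∀ {n k} (w : Fin k → ℚ) (z : Fin k → ℚVec n) {u} → (∀ i → 0ℚ ≤ w i) → sumℚ w ≡ 1ℚ →
  (∀ i → 0ℚ < w i → z i ≈ℚ u) → comb w z ≈ℚ u
comb-constant w z {u} w≥0 Σw≡1 z≈u j = begin
  sumℚ (λ i → w i * z i j)    ≡⟨ sumℚ-cong term ⟩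
  sumℚ (λ i → w i * u j)      ≡⟨ *-distribʳ-sumℚ (u j) w ⟩
  sumℚ w * u j                ≡⟨ cong (_* u j) Σw≡1 ⟩
  1ℚ * u j                    ≡⟨ *-identityˡ (u j) ⟩
  u j                         ∎
  where
  open ≡-Reasoning
  term : ∀ i → w i * z i j ≡ w i * u j
  term i with <-cmp 0ℚ (w i)
  ... | tri< 0<wi _ _ = cong (w i *_) (z≈u i 0<wi j)
  ... | tri≈ _ 0≡wi _ rewrite sym 0≡wi = trans (*-zeroˡ (z i j)) (sym (*-zeroˡ (u j)))
  ... | tri> _ _ wi<0 = ⊥-elim (<-irrefl refl (<-≤-trans wi<0 (w≥0 i)))

module Lifting {m n k} {Q : Region m} {ys : Fin k → ℚVec m} (Q≐ : Q ≐ Hull ys)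
  (M : IntMatrix m n) (S : List (ℤVec n))
  (S-over-Q : ∀ s → s ∈ S → Q (embed (apply M s)))
  (lifts : ∀ v → IsVertex Q v →
    Σ (ℤVec n) (λ s → s ∈ S × (embed (apply M s) ≈ℚ v)) ×
    (∀ s s' → s ∈ S → s' ∈ S → embed (apply M s) ≈ℚ v → embed (apply M s') ≈ℚ v → s ≈ℤ s')) where

  Q-convex : IsConvex Q
  Q-convex = ≐-isConvex Q≐ (Hull-isConvex ys)

  Q-respects≈ : Respects≈ Q
  Q-respects≈ = ≐-respects≈ Q≐ (Hull-respects≈ ys)

  lift : ∀ {v} → IsVertex Q v → ℤVec n
  lift v-vertex = proj₁ (proj₁ (lifts _ v-vertex))

  lift∈S : ∀ {v} (v-vertex : IsVertex Q v) → lift v-vertex ∈ S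
  lift∈S v-vertex = proj₁ (proj₂ (proj₁ (lifts _ v-vertex)))

  lift-over : ∀ {v} (v-vertex : IsVertex Q v) → applyℚ M (embed (lift v-vertex)) ≈ℚ v
  lift-over v-vertex i = trans (applyℚ-embed M (lift v-vertex) i) (proj₂ (proj₂ (proj₁ (lifts _ v-vertex))) i)

  ∈⇒Conv : ∀ {s} → s ∈ S → Conv S (embed s)
  ∈⇒Conv s∈S = subst (λ s → Conv S (embed s)) (sym (lookup-index s∈S)) (Hull-generator (generators S) (index s∈S))

  generator-over-Q : ∀ i → Q (applyℚ M (generators S i))
  generator-over-Q i = Q-respects≈ (λ j → sym (applyℚ-embed M (lookup S i) j)) (S-over-Q _ (∈-lookup i))

  Image-S⊆Q : Image M (Conv S) ⊆ Q
  Image-S⊆Q y∈ = Hull-least _ Q-convex Q-respects≈ generator-over-Q (≐⇒⊆ (Image-Hull M (generators S)) y∈)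

  Q⊆Image-S : VertexHull Q → Q ⊆ Image M (Conv S)
  Q⊆Image-S record { vertex = vs ; isVertex = vs-vertex ; spans = Q≐vs } Qy =
    Image-mono M (Hull-⊆ (λ t → ∈⇒Conv (lift∈S (vs-vertex t))))
      (≐⇒⊆ (≐-sym (Image-Hull M (λ t → embed (lift (vs-vertex t)))))
        (≐⇒⊆ (Hull-cong (λ t j → sym (lift-over (vs-vertex t) j))) (≐⇒⊆ Q≐vs Qy)))

  -- Every weight of a point over a vertex v sits on a generator over v, and v has only one lift.
  vertex-fibre : ∀ {v x} (v-vertex : IsVertex Q v) → Conv S x → applyℚ M x ≈ℚ v → x ≈ℚ embed (lift v-vertex)
  vertex-fibre {v} {x} v-vertex (w , w≥0 , Σw≡1 , x≡) Mx≈v j =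
    trans (x≡ j) (comb-constant w (generators S) w≥0 Σw≡1 over-v⇒lift j)
    where
    v≡comb : ∀ i → v i ≡ comb w (λ t → applyℚ M (generators S t)) i
    v≡comb i = trans (sym (Mx≈v i)) (trans (applyℚ-cong M x≡ i) (applyℚ-comb M w (generators S) i))
    over-v⇒lift : ∀ t → 0ℚ < w t → generators S t ≈ℚ embed (lift v-vertex)
    over-v⇒lift t wt>0 j = cong (_/ 1) (proj₂ (lifts v v-vertex) (lookup S t) (lift v-vertex) (∈-lookup t) (lift∈S v-vertex)
      (λ i → trans (sym (applyℚ-embed M (lookup S t) i))
                   (vertex-support Q-convex v-vertex w _ w≥0 Σw≡1 generator-over-Q v≡comb t wt>0 i))
      (proj₂ (proj₂ (proj₁ (lifts v v-vertex)))) j)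

  -- Translating A by the B-part of the lift of v lands in the fibre over v, which is a single point.
  summand-rigid : ∀ {A B : Region n} → Conv S ≐ (A ⊕ B) → ∀ {v} → IsVertex Q v →
    (∀ {a a'} → A a → A a' → applyℚ M a ≈ℚ applyℚ M a') → ∀ {x x'} → A x → A x' → x ≈ℚ x'
  summand-rigid {A} S≐ {v} v-vertex A-flat {x} {x'} Ax Ax' j =
    ∙-cancelʳ (b j) (x j) (x' j) (trans (over-lift Ax j) (sym (over-lift Ax' j)))
    where
    split = proj₁ (S≐ _) (∈⇒Conv (lift∈S v-vertex))
    a = proj₁ split
    b = proj₁ (proj₂ split)
    Aa = proj₁ (proj₂ (proj₂ split))
    Bb = proj₁ (proj₂ (proj₂ (proj₂ split)))
    lift≡ = proj₂ (proj₂ (proj₂ (proj₂ split)))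
    over-lift : ∀ {y} → A y → (λ i → y i + b i) ≈ℚ embed (lift v-vertex)
    over-lift {y} Ay = vertex-fibre v-vertex (proj₂ (S≐ _) (y , b , Ay , Bb , λ i → refl)) λ i → begin
      applyℚ M (λ i → y i + b i) i            ≡⟨ applyℚ-+ M y b i ⟩
      applyℚ M y i + applyℚ M b i             ≡⟨ cong (_+ applyℚ M b i) (A-flat Ay Aa i) ⟩
      applyℚ M a i + applyℚ M b i             ≡⟨ applyℚ-+ M a b i ⟨
      applyℚ M (λ i → a i + b i) i            ≡⟨ applyℚ-cong M lift≡ i ⟨
      applyℚ M (embed (lift v-vertex)) i      ≡⟨ lift-over v-vertex i ⟩
      v i                                     ∎
      where open ≡-Reasoning

  Q≐Image-S : VertexHull Q → Q ≐ Image M (Conv S)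
  Q≐Image-S vertexHull = ⊆-antisym (Q⊆Image-S vertexHull) Image-S⊆Q

  image-decomposition : ∀ VA VB → VertexHull Q → Conv S ≐ (Conv VA ⊕ Conv VB) →
    Q ≐ (Conv (map (apply M) VA) ⊕ Conv (map (apply M) VB))
  image-decomposition VA VB vertexHull S≐ =
    ≐-trans (Q≐Image-S vertexHull)
      (≐-trans (Image-cong M S≐) (≐-trans (Image-⊕ M) (⊕-cong (Image-Conv M VA) (Image-Conv M VB))))

  image-summand-big : ∀ VA {B : Region n} → VertexHull Q → Conv S ≐ (Conv VA ⊕ B) → Σ _ B →
    MoreThanOnePoint (Conv VA) → ¬ ¬ MoreThanOnePoint (Conv (map (apply M) VA))
  image-summand-big VA vertexHull S≐ (b , Bb) (a , a' , Aa , Aa' , a≉a') image-point =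
    a≉a' (summand-rigid S≐ (proj₂ vertex) A-flat Aa Aa')
    where
    vertex = vertex-exists vertexHull
      (Image-S⊆Q ((λ j → a j + b j) , proj₂ (S≐ _) (a , b , Aa , Bb , λ j → refl) , λ i → refl))
    A-flat : ∀ {x x'} → Conv VA x → Conv VA x' → applyℚ M x ≈ℚ applyℚ M x'
    A-flat {x} {x'} Ax Ax' with applyℚ M x ≈ℚ? applyℚ M x'
    ... | yes Mx≈Mx' = Mx≈Mx'
    ... | no Mx≉Mx' = ⊥-elim (image-point (applyℚ M x , applyℚ M x' ,
            ≐⇒⊆ (Image-Conv M VA) (x , Ax , λ i → refl) , ≐⇒⊆ (Image-Conv M VA) (x' , Ax' , λ i → refl) , Mx≉Mx'))

theorem9 : ∀ {m n : ℕ} (Q : Region m) → IntegrallyIndecomposable Q →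
    (π : IntMatrix m n) (S : List (ℤVec n)) →
    (∀ s → s ∈ S → Q (embed (apply π s))) →
    (∀ v → IsVertex Q v →
      Σ (ℤVec n) (λ s → s ∈ S × (embed (apply π s) ≈ℚ v)) ×
      (∀ s s' → s ∈ S → s' ∈ S → embed (apply π s) ≈ℚ v → embed (apply π s') ≈ℚ v → s ≈ℤ s')) →
    IntegrallyIndecomposable (Conv S)
theorem9 Q ((VQ , Q≐) , Q-indecomposable) π S S-over-Q lifts =
  (S , ≐-refl) , λ (VA , VB , A-big , B-big , S≐) →
    ¬¬vertexHull (generators VQ) Q≐ λ vertexHull →
      image-summand-big VA vertexHull S≐ (point B-big) A-big λ πA-big →
      image-summand-big VB vertexHull (≐-trans S≐ ⊕-comm) (point A-big) B-big λ πB-big →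
      Q-indecomposable (map (apply π) VA , map (apply π) VB , πA-big , πB-big ,
                        image-decomposition VA VB vertexHull S≐)
  where
  open Lifting Q≐ π S S-over-Q lifts
  point : ∀ {n} {P : Region n} → MoreThanOnePoint P → Σ _ P
  point (x , _ , Px , _) = x , Px
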